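{- Let $p,\ell$ be distinct odd primes with $p\equiv 1\pmod\ell$, and let $s\in\mathbb{Z}$. Then $\ell^2\mid s^2-4p$ if and only if $\ell^2\mid p+1-s$ or $\ell^2\mid p+1+s$. -}

-- Put p = 1 + q with ℓ ∣ q, a = p + 1 - s and b = p + 1 + s. Then s² - 4p = q² - a b, and ℓ² ∣ q²,
-- so ℓ² ∣ s² - 4p exactly when ℓ² ∣ a b. Since a + b = 2q + 4 and ℓ is odd, ℓ cannot divide both
-- a and b, and then ℓ² ∣ a b forces ℓ² to divide one of them.
module Submission where

open import Data.Nat using (ℕ; _∸_; suc; NonZero)
import Data.Nat as ℕ
import Data.Nat.Properties as ℕP
import Data.Nat.Divisibility as ℕD
open import Data.Nat.Primality using (Prime; euclidsLemma; prime⇒nonZero; prime⇒irreducible; prime[2]; ¬prime[1])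
open import Data.Integer using (ℤ; +_; _+_; _-_; _*_; ∣_∣)
open import Data.Integer.Divisibility using (_∣_; *-monoˡ-∣; *-monoʳ-∣)
import Data.Integer.Divisibility.Signed as ℤS
open import Data.Integer.Properties using (abs-*; neg-involutive)
open import Data.Integer.Tactic.RingSolver using (solve-∀)
open import Data.Sum using (_⊎_; inj₁; inj₂; [_,_])
import Data.Sum as Sum
open import Data.Product using (_×_; _,_)
open import Relation.Binary.PropositionalEquality using (_≡_; _≢_; refl; sym; trans; cong; subst; subst₂)
open import Relation.Nullary using (¬_; yes; no; contradiction)
open import Function.Bundles using (_⇔_; mk⇔)
open import Function.Properties.Equivalence using () renaming (trans to ⇔-trans)

prime²∣m*n∧∤n⇒prime²∣m : ∀ {p m n} → Prime p → p ℕ.* p ℕD.∣ m ℕ.* n → ¬ p ℕD.∣ n → p ℕ.* p ℕD.∣ m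
prime²∣m*n∧∤n⇒prime²∣m {p} {m} {n} p-prime p²∣mn p∤n
  with euclidsLemma m n p-prime (ℕD.∣-trans (ℕD.m∣m*n p) p²∣mn)
... | inj₂ p∣n = contradiction p∣n p∤n
... | inj₁ (ℕD.divides k refl) = ℕD.*-monoˡ-∣ p p∣k
  where
  instance _ = prime⇒nonZero p-prime
  k*p*n≡p*[k*n] : k ℕ.* p ℕ.* n ≡ p ℕ.* (k ℕ.* n)
  k*p*n≡p*[k*n] = trans (cong (ℕ._* n) (ℕP.*-comm k p)) (ℕP.*-assoc p k n)
  p∣k*n : p ℕD.∣ k ℕ.* n
  p∣k*n = ℕD.*-cancelˡ-∣ p (subst (p ℕ.* p ℕD.∣_) k*p*n≡p*[k*n] p²∣mn)
  p∣k : p ℕD.∣ k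
  p∣k = Sum.fromInj₁ (λ p∣n → contradiction p∣n p∤n) (euclidsLemma k n p-prime p∣k*n)

prime²∣m*n⇒prime²∣m⊎prime²∣n : ∀ {p m n} → Prime p → ¬ (p ℕD.∣ m × p ℕD.∣ n) →
  p ℕ.* p ℕD.∣ m ℕ.* n → p ℕ.* p ℕD.∣ m ⊎ p ℕ.* p ℕD.∣ n
prime²∣m*n⇒prime²∣m⊎prime²∣n {p} {m} {n} p-prime p∤m∧n p²∣mn with p ℕD.∣? n
... | no p∤n = inj₁ (prime²∣m*n∧∤n⇒prime²∣m p-prime p²∣mn p∤n)
... | yes p∣n = inj₂ (prime²∣m*n∧∤n⇒prime²∣m p-prime
                        (subst (p ℕ.* p ℕD.∣_) (ℕP.*-comm m n) p²∣mn) (λ p∣m → p∤m∧n (p∣m , p∣n)))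

odd-prime∤4 : ∀ {p} → Prime p → p ≢ 2 → ¬ p ℕD.∣ 4
odd-prime∤4 {p} p-prime p≢2 p∣4 = [ p∤2 , p∤2 ] (euclidsLemma 2 2 p-prime p∣4)
  where
  p∤2 : ¬ p ℕD.∣ 2
  p∤2 p∣2 = [ (λ p≡1 → ¬prime[1] (subst Prime p≡1 p-prime)) , p≢2 ] (prime⇒irreducible prime[2] p∣2)

prime²∣i*j⇔prime²∣i⊎prime²∣j : ∀ {p i j} → Prime p → ¬ ((+ p ∣ i) × (+ p ∣ j)) →
  (+ p * + p ∣ i * j) ⇔ ((+ p * + p ∣ i) ⊎ (+ p * + p ∣ j))
prime²∣i*j⇔prime²∣i⊎prime²∣j {p} {i} {j} p-prime p∤i∧j = mk⇔ to from
  where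
  ∣p²∣≡p*p : ∣ + p * + p ∣ ≡ p ℕ.* p
  ∣p²∣≡p*p = abs-* (+ p) (+ p)
  to : + p * + p ∣ i * j → (+ p * + p ∣ i) ⊎ (+ p * + p ∣ j)
  to p²∣ij = Sum.map (subst (ℕD._∣ ∣ i ∣) (sym ∣p²∣≡p*p)) (subst (ℕD._∣ ∣ j ∣) (sym ∣p²∣≡p*p))
    (prime²∣m*n⇒prime²∣m⊎prime²∣n p-prime p∤i∧j (subst₂ ℕD._∣_ ∣p²∣≡p*p (abs-* i j) p²∣ij))
  from : (+ p * + p ∣ i) ⊎ (+ p * + p ∣ j) → + p * + p ∣ i * j
  from p²∣i∨j = subst (∣ + p * + p ∣ ℕD.∣_) (sym (abs-* i j))
    ([ ℕD.∣m⇒∣m*n ∣ j ∣ , ℕD.∣n⇒∣m*n ∣ i ∣ ] p²∣i∨j)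

∣m⇒∣m-n⇔∣n : ∀ {d m n} → d ∣ m → (d ∣ m - n) ⇔ (d ∣ n)
∣m⇒∣m-n⇔∣n {d} {m} {n} d∣m = mk⇔ to from
  where
  to : d ∣ m - n → d ∣ n
  to d∣m-n = ℤS.∣⇒∣ᵤ (subst (d ℤS.∣_) (neg-involutive n)
    (ℤS.∣m⇒∣-m (ℤS.∣m+n∣m⇒∣n (ℤS.∣ᵤ⇒∣ {d} {m - n} d∣m-n) (ℤS.∣ᵤ⇒∣ {d} {m} d∣m))))
  from : d ∣ n → d ∣ m - n
  from d∣n = ℤS.∣⇒∣ᵤ (ℤS.∣m∣n⇒∣m-n (ℤS.∣ᵤ⇒∣ {d} {m} d∣m) (ℤS.∣ᵤ⇒∣ {d} {n} d∣n))

discriminant≡square-product : ∀ s q →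
  s * s - + 4 * (+ 1 + q) ≡ q * q - (+ 1 + q + + 1 - s) * (+ 1 + q + + 1 + s)
discriminant≡square-product = solve-∀

factor-sum≡2q+4 : ∀ s q → (+ 1 + q + + 1 - s) + (+ 1 + q + + 1 + s) - + 2 * q ≡ + 4
factor-sum≡2q+4 = solve-∀

discriminant-divisibility : ∀ {ℓ} → Prime ℓ → ℓ ≢ 2 → (p : ℕ) .{{_ : NonZero p}} → ℓ ℕD.∣ p ∸ 1 → (s : ℤ) →
  (+ ℓ * + ℓ ∣ s * s - + 4 * + p) ⇔ ((+ ℓ * + ℓ ∣ + p + + 1 - s) ⊎ (+ ℓ * + ℓ ∣ + p + + 1 + s))
discriminant-divisibility {ℓ} ℓ-prime ℓ≢2 (suc q) ℓ∣q s =
  subst (λ z → (+ ℓ * + ℓ ∣ z) ⇔ ((+ ℓ * + ℓ ∣ a) ⊎ (+ ℓ * + ℓ ∣ b)))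
    (sym (discriminant≡square-product s (+ q)))
    (⇔-trans (∣m⇒∣m-n⇔∣n {+ ℓ * + ℓ} {+ q * + q} {a * b} ℓ²∣q²)
      (prime²∣i*j⇔prime²∣i⊎prime²∣j {ℓ} {a} {b} ℓ-prime ℓ∤a∧b))
  where
  a b : ℤ
  a = + suc q + + 1 - s
  b = + suc q + + 1 + s
  ℓ²∣q² : + ℓ * + ℓ ∣ + q * + q
  ℓ²∣q² = ℕD.∣-trans (*-monoˡ-∣ (+ ℓ) {+ ℓ} {+ q} ℓ∣q) (*-monoʳ-∣ (+ q) {+ ℓ} {+ q} ℓ∣q)
  ℓ∤a∧b : ¬ ((+ ℓ ∣ a) × (+ ℓ ∣ b))
  ℓ∤a∧b (ℓ∣a , ℓ∣b) = odd-prime∤4 ℓ-prime ℓ≢2 (ℤS.∣⇒∣ᵤ (subst (+ ℓ ℤS.∣_) (factor-sum≡2q+4 s (+ q))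
    (ℤS.∣m∣n⇒∣m-n (ℤS.∣m∣n⇒∣m+n (ℤS.∣ᵤ⇒∣ {+ ℓ} {a} ℓ∣a) (ℤS.∣ᵤ⇒∣ {+ ℓ} {b} ℓ∣b))
      (ℤS.∣n⇒∣m*n (+ 2) (ℤS.∣ᵤ⇒∣ {+ ℓ} {+ q} ℓ∣q)))))

lemma2p5 : (p ℓ : ℕ) → Prime p → Prime ℓ → p ≢ 2 → ℓ ≢ 2 → p ≢ ℓ → ℓ ℕD.∣ p ∸ 1 → (s : ℤ) →
    ((+ ℓ) * (+ ℓ) ∣ s * s - (+ 4) * (+ p)) ⇔ (((+ ℓ) * (+ ℓ) ∣ (+ p) + (+ 1) - s) ⊎ ((+ ℓ) * (+ ℓ) ∣ (+ p) + (+ 1) + s))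
lemma2p5 p ℓ p-prime ℓ-prime _ ℓ≢2 _ =
  discriminant-divisibility ℓ-prime ℓ≢2 p {{prime⇒nonZero p-prime}}
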